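{- Let $G$ be a complete signed graph, let $u\neq v$ with $\{u,v\}$ of sign $+$ in $G$, and let $H$ be obtained from $G$ by flipping the sign of $\{u,v\}$ to $-$. Then: \begin{enumerate} \item If $w\in N_{G^+}(u)\cap N_{G^+}(v)$, then $\mathrm{NonAgreement}_{H^+}(u,w)>\mathrm{NonAgreement}_{G^+}(u,w)$. \item If $w\in N_{G^+}(u)\setminus N_{G^+}(v)$, $|N_{G^+}(u)|\leq|N_{G^+}(w)|$, and $w\neq v$, then $\mathrm{NonAgreement}_{H^+}(u,w)<\mathrm{NonAgreement}_{G^+}(u,w)$. \item Let $T=|N_{G^+}(u)\,\Delta\,N_{G^+}(w)|$ where $w\in N_{G^+}(u)\setminus N_{G^+}(v)$, $|N_{G^+}(u)|>|N_{G^+}(w)|$, and $w\neq v$. Then (a) $T<|N_{G^+}(u)|$ implies $\mathrm{NonAgreement}_{G^+}(u,w)>\mathrm{NonAgreement}_{H^+}(u,w)$; (b) $T=|N_{G^+}(u)|$ implies $\mathrm{NonAgreement}_{G^+}(u,w)=\mathrm{NonAgreement}_{H^+}(u,w)$; (c) $T>|N_{G^+}(u)|$ implies $\mathrm{NonAgreement}_{G^+}(u,w)<\mathrm{NonAgreement}_{H^+}(u,w)$. \item If $w\notin N_{G^+}(u)\cup N_{G^+}(v)$, then $\mathrm{NonAgreement}_{G^+}(x,w)=\mathrm{NonAgreement}_{H^+}(x,w)$ for every $x\in N_{G^+}(w)$. \end{enumerate}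
   Context: A complete signed graph on a finite vertex set $V$ assigns to every unordered pair of distinct vertices a sign $+$ or $-$. For such a graph $X$, its positive graph $X^+$ has vertex set $V$ and as edges the pairs of sign $+$; $N_{X^+}(a)$ is the open neighborhood of $a$ in $X^+$. $\mathrm{NonAgreement}_{X^+}(a,b)=\frac{|N_{X^+}(a)\,\Delta\,N_{X^+}(b)|}{\max\{|N_{X^+}(a)|,|N_{X^+}(b)|\}}$, where $\Delta$ is symmetric difference. -}

module Defs where

open import Data.Bool using (Bool; true; false; _∧_; not)
open import Data.Nat using (ℕ; zero; suc; _⊔_)
open import Data.Fin using (Fin; _≟_)
open import Data.Fin.Subset using (Subset; _∪_; _─_; ∣_∣)
open import Data.Vec using (tabulate)
open import Data.Integer using (+_)
open import Data.Rational using (ℚ; _/_; 0ℚ)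
open import Data.Product using (_×_; _,_)
open import Data.Sum using (_⊎_)
open import Relation.Nullary using (¬_; does)
open import Relation.Binary.PropositionalEquality using (_≡_; _≢_)

-- A complete signed graph on the vertex set Fin n: every pair of vertices
-- gets a sign (true = +, false = -), symmetrically.  The value on the
-- diagonal (a , a) is irrelevant and ignored.
record SignedGraph (n : ℕ) : Set where
  field
    sign : Fin n → Fin n → Bool
    sign-sym : ∀ a b → sign a b ≡ sign b a
open SignedGraph public

N⁺ : ∀ {n} → SignedGraph n → Fin n → Subset n
N⁺ X a = tabulate λ b → not (does (a ≟ b)) ∧ sign X a b

_Δ_ : ∀ {n} → Subset n → Subset n → Subset n
p Δ q = (p ─ q) ∪ (q ─ p)

-- Convention: when the denominator is 0 (both neighbourhoods empty) the
-- value is 0 (the paper leaves this undefined; it never arises in lemma2).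
NonAgreement : ∀ {n} → SignedGraph n → Fin n → Fin n → ℚ
NonAgreement X a b with ∣ N⁺ X a ∣ ⊔ ∣ N⁺ X b ∣
... | zero = 0ℚ
... | suc m = (+ ∣ N⁺ X a Δ N⁺ X b ∣) / suc m

IsFlip : ∀ {n} → SignedGraph n → SignedGraph n → Fin n → Fin n → Set
IsFlip G H u v =
  sign H u v ≡ false ×
  (∀ a b → a ≢ b → ¬ ((a ≡ u × b ≡ v) ⊎ (a ≡ v × b ≡ u)) →
     sign H a b ≡ sign G a b)

-- Flipping {u,v} only deletes v from N(u) and u from N(v); every other neighbourhood is
-- unchanged.  So for w ∈ N(u) the denominator max(|N(u)|, |N(w)|) drops by at most one, while
-- the numerator |N(u) Δ N(w)| moves by exactly one: up if v ∈ N(w), down otherwise.  When the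
-- numerator rises, or falls over a fixed denominator, the comparison is immediate; when both
-- drop by one (v ∉ N(w), |N(w)| < |N(u)|), T/m against (T-1)/(m-1) is decided by T against m.
-- For w outside N(u) ∪ N(v) and x ∈ N(w), neither x nor w is u or v, so nothing changes.
module Submission where

open import Defs
open import Data.Nat using (ℕ; zero; suc; _*_; _≤_; _<_; _⊔_; z≤n; s≤s)
open import Data.Nat.Properties
  using (≤-trans; <⇒≤; ≤-pred; n≤1+n; n<1+n; suc-injective; +-monoˡ-<; *-comm; *-suc;
         *-monoʳ-≤; *-monoˡ-<; m≤n⊔m; ⊔-monoˡ-≤; m≤n⇒m⊔n≡n; m≥n⇒m⊔n≡m; module ≤-Reasoning)
open import Data.Fin using (Fin; zero; suc; _≟_)
import Data.Fin.Properties as Fin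
open import Data.Fin.Subset using (Subset; _∈_; _∉_; _∩_; _─_; _∪_; ∣_∣)
open import Data.Fin.Subset.Properties using (x∈p∩q⁻; x∈p∪q⁺; p─q⊆p; x∈p⇒∣p-x∣<∣p∣)
open import Data.Bool using (true; false; not; _∧_; _xor_)
open import Data.Bool.Properties using (∧-zeroʳ)
open import Data.Vec using ([]; _∷_; lookup; here; there)
open import Data.Vec.Properties using (lookup∘tabulate; []=⇒lookup; lookup⇒[]=)
open import Data.Integer using (+_)
import Data.Integer as ℤ
open import Data.Integer.Properties using (pos-*)
open import Data.Rational using (ℚ; _/_; 0ℚ; fromℚᵘ) renaming (_<_ to _<ℚ_)
open import Data.Rational.Properties using (toℚᵘ-cancel-<; toℚᵘ-fromℚᵘ; fromℚᵘ-cong)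
open import Data.Rational.Unnormalised using (mkℚᵘ; *<*; *≡*) renaming (_<_ to _<ᵘ_)
open import Data.Rational.Unnormalised.Properties using (<-respˡ-≃; <-respʳ-≃; ≃-sym)
open import Data.Product using (_×_; _,_; proj₁; proj₂)
open import Data.Sum using (_⊎_; inj₁; inj₂)
open import Relation.Nullary using (¬_; does; yes; no; contradiction)
open import Relation.Binary.PropositionalEquality
open import Function using (_∘_)

private
  variable
    n : ℕ

lookup-ext : ∀ {p q : Subset n} → (∀ j → lookup p j ≡ lookup q j) → p ≡ q
lookup-ext {p = []}    {[]}    _  = refl
lookup-ext {p = x ∷ p} {y ∷ q} eq = cong₂ _∷_ (eq zero) (lookup-ext (eq ∘ suc))

record EqualExcept (i : Fin n) (p q : Subset n) : Set where
  constructor equalExcept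
  field
    app : ∀ j → j ≢ i → lookup p j ≡ lookup q j
open EqualExcept

EqualExcept-sym : ∀ {i} {p q : Subset n} → EqualExcept i p q → EqualExcept i q p
EqualExcept-sym p≈q = equalExcept λ j j≢i → sym (p≈q .app j j≢i)

equalExcept⇒∣p∣≡1+∣q∣ : ∀ {i} {p q : Subset n} → EqualExcept i p q →
  lookup p i ≡ true → lookup q i ≡ false → ∣ p ∣ ≡ suc ∣ q ∣
equalExcept⇒∣p∣≡1+∣q∣ {i = zero} {true ∷ p} {false ∷ q} p≈q _ _ =
  cong (suc ∘ ∣_∣) (lookup-ext {p = p} {q} λ j → p≈q .app (suc j) λ ())
equalExcept⇒∣p∣≡1+∣q∣ {i = suc i} {x ∷ p} {y ∷ q} p≈q p∋i q∌i with p≈q .app zero (λ ())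
... | refl = cons x {p} {q} (equalExcept⇒∣p∣≡1+∣q∣ tail≈ p∋i q∌i)
  where
  tail≈ : EqualExcept i p q
  tail≈ = equalExcept λ j j≢i → p≈q .app (suc j) (j≢i ∘ Fin.suc-injective)
  cons : ∀ x {p q : Subset _} → ∣ p ∣ ≡ suc ∣ q ∣ → ∣ x ∷ p ∣ ≡ suc ∣ x ∷ q ∣
  cons true  = cong suc
  cons false e = e

lookup-Δ : ∀ (p q : Subset n) j → lookup (p Δ q) j ≡ lookup p j xor lookup q j
lookup-Δ (true  ∷ p) (true  ∷ q) zero    = refl
lookup-Δ (true  ∷ p) (false ∷ q) zero    = refl
lookup-Δ (false ∷ p) (true  ∷ q) zero    = refl
lookup-Δ (false ∷ p) (false ∷ q) zero    = refl
lookup-Δ (_     ∷ p) (_     ∷ q) (suc j) = lookup-Δ p q j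

EqualExcept-Δ : ∀ {i} {p q : Subset n} r → EqualExcept i p q → EqualExcept i (p Δ r) (q Δ r)
EqualExcept-Δ {p = p} {q} r p≈q = equalExcept λ j j≢i → begin
  lookup (p Δ r) j             ≡⟨ lookup-Δ p r j ⟩
  lookup p j xor lookup r j    ≡⟨ cong (_xor lookup r j) (p≈q .app j j≢i) ⟩
  lookup q j xor lookup r j    ≡⟨ lookup-Δ q r j ⟨
  lookup (q Δ r) j             ∎
  where open ≡-Reasoning

module _ {i} {p q : Subset n} (p≈q : EqualExcept i p q)
         (p∋i : lookup p i ≡ true) (q∌i : lookup q i ≡ false) (r : Subset n) where

  equalExcept⇒∣qΔr∣≡1+∣pΔr∣ : lookup r i ≡ true → ∣ q Δ r ∣ ≡ suc ∣ p Δ r ∣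
  equalExcept⇒∣qΔr∣≡1+∣pΔr∣ r∋i = equalExcept⇒∣p∣≡1+∣q∣ (EqualExcept-sym (EqualExcept-Δ r p≈q))
    (trans (lookup-Δ q r i) (cong₂ _xor_ q∌i r∋i))
    (trans (lookup-Δ p r i) (cong₂ _xor_ p∋i r∋i))

  equalExcept⇒∣pΔr∣≡1+∣qΔr∣ : lookup r i ≡ false → ∣ p Δ r ∣ ≡ suc ∣ q Δ r ∣
  equalExcept⇒∣pΔr∣≡1+∣qΔr∣ r∌i = equalExcept⇒∣p∣≡1+∣q∣ (EqualExcept-Δ r p≈q)
    (trans (lookup-Δ p r i) (cong₂ _xor_ p∋i r∌i))
    (trans (lookup-Δ q r i) (cong₂ _xor_ q∌i r∌i))

x∈p─q⇒q∌x : ∀ {x} (p q : Subset n) → x ∈ p ─ q → lookup q x ≡ false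
x∈p─q⇒q∌x (_     ∷ p) (_     ∷ q) (there x∈p─q) = x∈p─q⇒q∌x p q x∈p─q
x∈p─q⇒q∌x (true  ∷ p) (false ∷ q) here          = refl
x∈p─q⇒q∌x {x = zero} (true  ∷ p) (true  ∷ q) ()
x∈p─q⇒q∌x {x = zero} (false ∷ p) (true  ∷ q) ()
x∈p─q⇒q∌x {x = zero} (false ∷ p) (false ∷ q) ()

x∈p⇒1≤∣p∣ : ∀ {x} {p : Subset n} → x ∈ p → 1 ≤ ∣ p ∣
x∈p⇒1≤∣p∣ x∈p = ≤-trans (s≤s z≤n) (x∈p⇒∣p-x∣<∣p∣ x∈p)

ratio : ℕ → ℕ → ℚ
ratio t zero    = 0ℚ
ratio t (suc m) = + t / suc m

fromℚᵘ-mono-< : ∀ {p q} → p <ᵘ q → fromℚᵘ p <ℚ fromℚᵘ q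
fromℚᵘ-mono-< {p} {q} p<q = toℚᵘ-cancel-<
  (<-respʳ-≃ (≃-sym (toℚᵘ-fromℚᵘ q)) (<-respˡ-≃ (≃-sym (toℚᵘ-fromℚᵘ p)) p<q))

ratio-<-cross : ∀ t t′ m m′ → t * suc m′ < t′ * suc m → ratio t (suc m) <ℚ ratio t′ (suc m′)
ratio-<-cross t t′ m m′ lt = fromℚᵘ-mono-< {mkℚᵘ (+ t) m} {mkℚᵘ (+ t′) m′}
  (*<* (subst₂ ℤ._<_ (pos-* t (suc m′)) (pos-* t′ (suc m)) (ℤ.+<+ lt)))

ratio-≡-cross : ∀ t t′ m m′ → t * suc m′ ≡ t′ * suc m → ratio t (suc m) ≡ ratio t′ (suc m′)
ratio-≡-cross t t′ m m′ eq = fromℚᵘ-cong {mkℚᵘ (+ t) m} {mkℚᵘ (+ t′) m′}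
  (*≡* (subst₂ _≡_ (pos-* t (suc m′)) (pos-* t′ (suc m)) (cong +_ eq)))

ratio-mono-< : ∀ {t t′ M M′} → t < t′ → 1 ≤ M′ → M′ ≤ M → ratio t M <ℚ ratio t′ M′
ratio-mono-< {t} {t′} {suc m} {suc m′} t<t′ _ M′≤M = ratio-<-cross t t′ m m′ (begin-strict
  t * suc m′  ≤⟨ *-monoʳ-≤ t M′≤M ⟩
  t * suc m   <⟨ *-monoˡ-< (suc m) t<t′ ⟩
  t′ * suc m  ∎)
  where open ≤-Reasoning

ratio-<-ratio-suc : ∀ {t a} → t < a → ratio t a <ℚ ratio (suc t) (suc a)
ratio-<-ratio-suc {t} {suc a} t<a = ratio-<-cross t (suc t) a (suc a)
  (subst (_< suc t * suc a) (sym (*-suc t (suc a))) (+-monoˡ-< (t * suc a) t<a))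

ratio-suc-<-ratio : ∀ {t a} → a < t → 1 ≤ a → ratio (suc t) (suc a) <ℚ ratio t a
ratio-suc-<-ratio {t} {suc a} a<t _ = ratio-<-cross (suc t) t (suc a) a
  (subst (suc t * suc a <_) (sym (*-suc t (suc a))) (+-monoˡ-< (t * suc a) a<t))

ratio-suc-self : ∀ {a} → 1 ≤ a → ratio (suc a) (suc a) ≡ ratio a a
ratio-suc-self {suc a} _ =
  ratio-≡-cross (suc (suc a)) (suc a) (suc a) a (*-comm (suc (suc a)) (suc a))

module _ (X : SignedGraph n) where

  lookup-N⁺ : ∀ a b → lookup (N⁺ X a) b ≡ not (does (a ≟ b)) ∧ sign X a b
  lookup-N⁺ a b = lookup∘tabulate _ b

  N⁺-sym : ∀ a b → lookup (N⁺ X a) b ≡ lookup (N⁺ X b) a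
  N⁺-sym a b rewrite lookup-N⁺ a b | lookup-N⁺ b a | sign-sym X a b with a ≟ b | b ≟ a
  ... | yes _   | yes _   = refl
  ... | no  _   | no  _   = refl
  ... | yes a≡b | no  b≢a = contradiction (sym a≡b) b≢a
  ... | no  a≢b | yes b≡a = contradiction (sym b≡a) a≢b

  N⁺-irrefl : ∀ a → lookup (N⁺ X a) a ≡ false
  N⁺-irrefl a rewrite lookup-N⁺ a a with a ≟ a
  ... | yes _   = refl
  ... | no  a≢a = contradiction refl a≢a

  adjacent⇒≢ : ∀ {a b} → lookup (N⁺ X a) b ≡ true → a ≢ b
  adjacent⇒≢ {a} a~a refl = contradiction (trans (sym a~a) (N⁺-irrefl a)) λ ()

  positive⇒adjacent : ∀ {a b} → a ≢ b → sign X a b ≡ true → lookup (N⁺ X a) b ≡ true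
  positive⇒adjacent {a} {b} a≢b ab⁺ rewrite lookup-N⁺ a b | ab⁺ with a ≟ b
  ... | yes a≡b = contradiction a≡b a≢b
  ... | no  _   = refl

  negative⇒nonadjacent : ∀ {a b} → sign X a b ≡ false → lookup (N⁺ X a) b ≡ false
  negative⇒nonadjacent {a} {b} ab⁻ =
    trans (lookup-N⁺ a b) (trans (cong (not (does (a ≟ b)) ∧_) ab⁻) (∧-zeroʳ _))

  NonAgreement-ratio : ∀ a b →
    NonAgreement X a b ≡ ratio ∣ N⁺ X a Δ N⁺ X b ∣ (∣ N⁺ X a ∣ ⊔ ∣ N⁺ X b ∣)
  NonAgreement-ratio a b with ∣ N⁺ X a ∣ ⊔ ∣ N⁺ X b ∣
  ... | zero  = refl
  ... | suc _ = refl

NonAgreement-cong : ∀ {X Y : SignedGraph n} {a b} → N⁺ X a ≡ N⁺ Y a → N⁺ X b ≡ N⁺ Y b →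
  NonAgreement X a b ≡ NonAgreement Y a b
NonAgreement-cong {X = X} {Y} {a} {b} Xa≡Ya Xb≡Yb
  rewrite NonAgreement-ratio X a b | NonAgreement-ratio Y a b | Xa≡Ya | Xb≡Yb = refl

module Flip {G H : SignedGraph n} {u v : Fin n} (u≢v : u ≢ v) (uv⁺ : sign G u v ≡ true)
            (flip : IsFlip G H u v) where

  N⁺-flip : ∀ {a b} → ¬ ((a ≡ u × b ≡ v) ⊎ (a ≡ v × b ≡ u)) →
    lookup (N⁺ H a) b ≡ lookup (N⁺ G a) b
  N⁺-flip {a} {b} off rewrite lookup-N⁺ H a b | lookup-N⁺ G a b with a ≟ b
  ... | yes _   = refl
  ... | no  a≢b = proj₂ flip a b a≢b off

  N⁺-unchanged : ∀ {a} → a ≢ u → a ≢ v → N⁺ H a ≡ N⁺ G a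
  N⁺-unchanged a≢u a≢v = lookup-ext λ _ →
    N⁺-flip λ { (inj₁ (a≡u , _)) → a≢u a≡u ; (inj₂ (a≡v , _)) → a≢v a≡v }

  N⁺u-equalExcept : EqualExcept v (N⁺ G u) (N⁺ H u)
  N⁺u-equalExcept = equalExcept λ _ b≢v →
    sym (N⁺-flip λ { (inj₁ (_ , b≡v)) → b≢v b≡v ; (inj₂ (u≡v , _)) → u≢v u≡v })

  v∈N⁺Gu : lookup (N⁺ G u) v ≡ true
  v∈N⁺Gu = positive⇒adjacent G u≢v uv⁺

  v∉N⁺Hu : lookup (N⁺ H u) v ≡ false
  v∉N⁺Hu = negative⇒nonadjacent H (proj₁ flip)

  ∣N⁺Gu∣≡1+∣N⁺Hu∣ : ∣ N⁺ G u ∣ ≡ suc ∣ N⁺ H u ∣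
  ∣N⁺Gu∣≡1+∣N⁺Hu∣ = equalExcept⇒∣p∣≡1+∣q∣ N⁺u-equalExcept v∈N⁺Gu v∉N⁺Hu

  NonAgreement-H-u : ∀ {w} → w ≢ u → w ≢ v →
    NonAgreement H u w ≡ ratio ∣ N⁺ H u Δ N⁺ G w ∣ (∣ N⁺ H u ∣ ⊔ ∣ N⁺ G w ∣)
  NonAgreement-H-u {w} w≢u w≢v rewrite NonAgreement-ratio H u w | N⁺-unchanged w≢u w≢v = refl

  module _ {w} (u~w : lookup (N⁺ G u) w ≡ true) where

    private
      a = ∣ N⁺ H u ∣
      b = ∣ N⁺ G w ∣

      1≤b : 1 ≤ b
      1≤b = x∈p⇒1≤∣p∣ (lookup⇒[]= u (N⁺ G w) (trans (N⁺-sym G w u) u~w))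

      w≢u : w ≢ u
      w≢u = adjacent⇒≢ G u~w ∘ sym

      ∣Δ∣-common : lookup (N⁺ G v) w ≡ true → ∣ N⁺ H u Δ N⁺ G w ∣ ≡ suc ∣ N⁺ G u Δ N⁺ G w ∣
      ∣Δ∣-common v~w = equalExcept⇒∣qΔr∣≡1+∣pΔr∣ N⁺u-equalExcept v∈N⁺Gu v∉N⁺Hu (N⁺ G w)
        (trans (N⁺-sym G w v) v~w)

      ∣Δ∣-private : lookup (N⁺ G v) w ≡ false → ∣ N⁺ G u Δ N⁺ G w ∣ ≡ suc ∣ N⁺ H u Δ N⁺ G w ∣
      ∣Δ∣-private v≁w = equalExcept⇒∣pΔr∣≡1+∣qΔr∣ N⁺u-equalExcept v∈N⁺Gu v∉N⁺Hu (N⁺ G w)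
        (trans (N⁺-sym G w v) v≁w)

    common-neighbour : lookup (N⁺ G v) w ≡ true → NonAgreement G u w <ℚ NonAgreement H u w
    common-neighbour v~w
      rewrite NonAgreement-ratio G u w | NonAgreement-H-u w≢u (adjacent⇒≢ G v~w ∘ sym)
            | ∣N⁺Gu∣≡1+∣N⁺Hu∣ | ∣Δ∣-common v~w
      = ratio-mono-< {t = ∣ N⁺ G u Δ N⁺ G w ∣} {M = suc a ⊔ b} {M′ = a ⊔ b}
          (n<1+n _) (≤-trans 1≤b (m≤n⊔m a b)) (⊔-monoˡ-≤ b (n≤1+n a))

    private-neighbour-≤ : lookup (N⁺ G v) w ≡ false → w ≢ v → ∣ N⁺ G u ∣ ≤ ∣ N⁺ G w ∣ →
      NonAgreement H u w <ℚ NonAgreement G u w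
    private-neighbour-≤ v≁w w≢v 1+a≤b
      rewrite NonAgreement-ratio G u w | NonAgreement-H-u w≢u w≢v
            | ∣N⁺Gu∣≡1+∣N⁺Hu∣ | ∣Δ∣-private v≁w
      = ratio-mono-< {t = ∣ N⁺ H u Δ N⁺ G w ∣} {M = a ⊔ b} {M′ = suc a ⊔ b}
          (n<1+n _) (≤-trans 1≤b (m≤n⊔m _ b)) (begin
            suc a ⊔ b  ≡⟨ m≤n⇒m⊔n≡n 1+a≤b ⟩
            b          ≤⟨ m≤n⊔m a b ⟩
            a ⊔ b      ∎)
      where open ≤-Reasoning

    private-neighbour-> : lookup (N⁺ G v) w ≡ false → w ≢ v → ∣ N⁺ G w ∣ < ∣ N⁺ G u ∣ →
      (∣ N⁺ G u Δ N⁺ G w ∣ < ∣ N⁺ G u ∣ → NonAgreement H u w <ℚ NonAgreement G u w)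
      × (∣ N⁺ G u Δ N⁺ G w ∣ ≡ ∣ N⁺ G u ∣ → NonAgreement G u w ≡ NonAgreement H u w)
      × (∣ N⁺ G u ∣ < ∣ N⁺ G u Δ N⁺ G w ∣ → NonAgreement G u w <ℚ NonAgreement H u w)
    private-neighbour-> v≁w w≢v b<1+a
      rewrite NonAgreement-ratio G u w | NonAgreement-H-u w≢u w≢v
            | ∣N⁺Gu∣≡1+∣N⁺Hu∣ | ∣Δ∣-private v≁w
            | m≥n⇒m⊔n≡m (<⇒≤ b<1+a) | m≥n⇒m⊔n≡m (≤-pred b<1+a)
      = (λ 1+t<1+a → ratio-<-ratio-suc (≤-pred 1+t<1+a))
      , (λ 1+t≡1+a → subst (λ t → ratio (suc t) (suc a) ≡ ratio t a) (sym (suc-injective 1+t≡1+a))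
                       (ratio-suc-self 1≤a))
      , (λ 1+a<1+t → ratio-suc-<-ratio (≤-pred 1+a<1+t) 1≤a)
      where
      1≤a : 1 ≤ a
      1≤a = ≤-trans 1≤b (≤-pred b<1+a)

  unaffected : ∀ {w} → lookup (N⁺ G u) w ≢ true → lookup (N⁺ G v) w ≢ true →
    ∀ {x} → lookup (N⁺ G w) x ≡ true → NonAgreement G x w ≡ NonAgreement H x w
  unaffected {w} u≁w v≁w {x} w~x =
    sym (NonAgreement-cong (N⁺-unchanged x≢u x≢v) (N⁺-unchanged w≢u w≢v))
    where
    w≢u : w ≢ u
    w≢u refl = v≁w (trans (N⁺-sym G v u) v∈N⁺Gu)
    w≢v : w ≢ v
    w≢v refl = u≁w v∈N⁺Gu
    x≢u : x ≢ u
    x≢u refl = u≁w (trans (N⁺-sym G u w) w~x)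
    x≢v : x ≢ v
    x≢v refl = v≁w (trans (N⁺-sym G v w) w~x)

lemma2 : ∀ {n} (G H : SignedGraph n) (u v : Fin n) →
    u ≢ v → sign G u v ≡ true → IsFlip G H u v →
    (∀ w → w ∈ N⁺ G u ∩ N⁺ G v →
       NonAgreement G u w <ℚ NonAgreement H u w)
    × (∀ w → w ∈ N⁺ G u ─ N⁺ G v → ∣ N⁺ G u ∣ ≤ ∣ N⁺ G w ∣ → w ≢ v →
       NonAgreement H u w <ℚ NonAgreement G u w)
    × (∀ w → w ∈ N⁺ G u ─ N⁺ G v → ∣ N⁺ G w ∣ < ∣ N⁺ G u ∣ → w ≢ v →
       (∣ N⁺ G u Δ N⁺ G w ∣ < ∣ N⁺ G u ∣ →
          NonAgreement H u w <ℚ NonAgreement G u w)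
       × (∣ N⁺ G u Δ N⁺ G w ∣ ≡ ∣ N⁺ G u ∣ →
          NonAgreement G u w ≡ NonAgreement H u w)
       × (∣ N⁺ G u ∣ < ∣ N⁺ G u Δ N⁺ G w ∣ →
          NonAgreement G u w <ℚ NonAgreement H u w))
    × (∀ w → w ∉ N⁺ G u ∪ N⁺ G v → ∀ x → x ∈ N⁺ G w →
       NonAgreement G x w ≡ NonAgreement H x w)
lemma2 G H u v u≢v uv⁺ flip =
    (λ w w∈u∩v → let w∈u , w∈v = x∈p∩q⁻ _ _ w∈u∩v in
       common-neighbour ([]=⇒lookup w∈u) ([]=⇒lookup w∈v))
  , (λ w w∈u─v a≤b w≢v →
       private-neighbour-≤ ([]=⇒lookup (p─q⊆p _ _ w∈u─v)) (x∈p─q⇒q∌x _ _ w∈u─v) w≢v a≤b)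
  , (λ w w∈u─v b<a w≢v →
       private-neighbour-> ([]=⇒lookup (p─q⊆p _ _ w∈u─v)) (x∈p─q⇒q∌x _ _ w∈u─v) w≢v b<a)
  , (λ w w∉u∪v x x∈w → unaffected (w∉u∪v ∘ x∈p∪q⁺ ∘ inj₁ ∘ lookup⇒[]= w _)
                                  (w∉u∪v ∘ x∈p∪q⁺ ∘ inj₂ ∘ lookup⇒[]= w _) ([]=⇒lookup x∈w))
  where
  open Flip u≢v uv⁺ flip
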